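{- Let $\sigma\in S_n$ be vexillary and, for $1\le i\le n$, let $l_i=|\{j:(j,i)\in\mathrm{Inv}(\sigma)\}|$ and $c_i=|\{j:(i,j)\in\mathrm{Inv}(\sigma)\}|$. Let $i,j\in\{1,\dots,n\}$. (1) If $l_i\le l_j$, then for every $a$, $(a,i)\in\mathrm{Inv}(\sigma)$ implies $(a,j)\in\mathrm{Inv}(\sigma)$. (2) If $c_i\le c_j$, then for every $a$, $(i,a)\in\mathrm{Inv}(\sigma)$ implies $(j,a)\in\mathrm{Inv}(\sigma)$.
   Context: For $\sigma\in S_n$, $\mathrm{Inv}(\sigma)=\{(a,b):1\le a<b\le n,\ \sigma^{ -1}(a)>\sigma^{ -1}(b)\}$. $d_i(\sigma)=|\{j>i:\sigma(j)<\sigma(i)\}|$, $g_i(\sigma)=|\{j<i:\sigma(j)>\sigma(i)\}|$; $\mu(\sigma)$, $\lambda(\sigma)$ are the partitions obtained by sorting $(d_i)$, resp. $(g_i)$, in nonincreasing order; $\sigma$ is vexillary iff $\lambda(\sigma)=\mu(\sigma)'$ ($'$ = conjugate partition). -}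

module Defs where

open import Data.Nat using (ℕ; zero; suc; _≤_; _<?_; _≤?_; _⊔_)
open import Data.Nat.Properties using (≤-refl)
open import Data.Fin using (Fin; _<_; _>_)
open import Data.Fin.Properties using (_<?_)
open import Data.Fin.Permutation using (Permutation′; _⟨$⟩ʳ_; _⟨$⟩ˡ_)
open import Data.List using (List; []; _∷_; map; filter; length; allFin; upTo)
open import Data.Product using (_×_)
open import Data.Product.Properties using ()
open import Relation.Nullary using (Dec; yes; no)
open import Relation.Nullary.Decidable using (_×-dec_)
open import Relation.Binary.PropositionalEquality using (_≡_)

-- Positions and values are Fin n (0-based instead of 1-based).
-- σ ⟨$⟩ʳ i = σ(i), σ ⟨$⟩ˡ a = σ⁻¹(a).

Inv : ∀ {n} → Permutation′ n → Fin n → Fin n → Set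
Inv σ a b = (a < b) × ((σ ⟨$⟩ˡ a) > (σ ⟨$⟩ˡ b))

Inv? : ∀ {n} (σ : Permutation′ n) (a b : Fin n) → Dec (Inv σ a b)
Inv? σ a b = (a Data.Fin.Properties.<? b) ×-dec ((σ ⟨$⟩ˡ b) Data.Fin.Properties.<? (σ ⟨$⟩ˡ a))

dStat : ∀ {n} → Permutation′ n → Fin n → ℕ
dStat {n} σ i = length (filter (λ j → (i Data.Fin.Properties.<? j) ×-dec ((σ ⟨$⟩ʳ j) Data.Fin.Properties.<? (σ ⟨$⟩ʳ i))) (allFin n))

gStat : ∀ {n} → Permutation′ n → Fin n → ℕ
gStat {n} σ i = length (filter (λ j → (j Data.Fin.Properties.<? i) ×-dec ((σ ⟨$⟩ʳ i) Data.Fin.Properties.<? (σ ⟨$⟩ʳ j))) (allFin n))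

insertDesc : ℕ → List ℕ → List ℕ
insertDesc x [] = x ∷ []
insertDesc x (y ∷ ys) with y Data.Nat.≤? x
... | yes _ = x ∷ y ∷ ys
... | no  _ = y ∷ insertDesc x ys

sortDesc : List ℕ → List ℕ
sortDesc [] = []
sortDesc (x ∷ xs) = insertDesc x (sortDesc xs)

-- A partition is a nonincreasing list of positive parts (zero parts dropped).
partitionOf : List ℕ → List ℕ
partitionOf xs = filter (λ k → 1 Data.Nat.≤? k) (sortDesc xs)

-- conjugate partition: μ'_k = |{ i : μ_i ≥ k }| for k = 1 .. max μ
conjugate : List ℕ → List ℕ
conjugate μ = map (λ k → length (filter (λ m → suc k Data.Nat.≤? m) μ))
                  (upTo (Data.List.foldr _⊔_ 0 μ))

muPart : ∀ {n} → Permutation′ n → List ℕ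
muPart {n} σ = partitionOf (map (dStat σ) (allFin n))

lambdaPart : ∀ {n} → Permutation′ n → List ℕ
lambdaPart {n} σ = partitionOf (map (gStat σ) (allFin n))

Vexillary : ∀ {n} → Permutation′ n → Set
Vexillary σ = lambdaPart σ ≡ conjugate (muPart σ)

lStat : ∀ {n} → Permutation′ n → Fin n → ℕ
lStat {n} σ i = length (filter (λ j → Inv? σ j i) (allFin n))

cStat : ∀ {n} → Permutation′ n → Fin n → ℕ
cStat {n} σ i = length (filter (λ j → Inv? σ i j) (allFin n))

-- Let L_i = {a : (a , i) ∈ Inv σ} and C_a = {i : (a , i) ∈ Inv σ}, so that l_i = |L_i| and
-- c_a = |C_a|.  Counting triples gives
--   Σ_a c_a² = Σ_{i,j} |L_i ∩ L_j| ≤ Σ_{i,j} min (l_i , l_j).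
-- Reindexed by σ, the c_a are the g_p and the l_i are the d_p, and for every partition
-- Σ_k (μ'_k)² = Σ_{p,q} min (μ_p , μ_q).  So λ(σ) = μ(σ)' turns the inequality into an
-- equality, which forces |L_i ∩ L_j| = min (l_i , l_j): the sets L_i are nested by size,
-- which is (1).  Part (2) follows from a general fact about 0/1 matrices: if the columns
-- are nested by size, so are the rows.
module Submission where

open import Defs
open import Data.Bool using (true; false; if_then_else_)
open import Data.Fin using (Fin; zero; suc; _<_)
open import Data.Fin.Permutation using (Permutation′; _⟨$⟩ʳ_; _⟨$⟩ˡ_; inverseˡ)
open import Data.Fin.Properties using (all?; ¬∀⟶∃¬)
open import Data.List using (List; []; _∷_; map; filter; length; allFin; tabulate; upTo; foldr)
open import Data.List.Properties using (map-∘; map-cong; map-cong-local; map-applyUpTo)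
open import Data.List.Relation.Binary.Permutation.Propositional
  using (_↭_; ↭-refl; ↭-prep; ↭-swap; ↭-trans)
open import Data.List.Relation.Binary.Permutation.Propositional.Properties using (map⁺)
open import Data.List.Relation.Unary.All as All using (All; []; _∷_)
open import Data.Nat using (ℕ; zero; suc; _+_; _*_; _≤_; _⊓_; _⊔_; z≤n; _≤?_)
open import Data.Nat.ListAction using (sum)
open import Data.Nat.ListAction.Properties using (sum-↭)
open import Data.Nat.Properties
open import Data.Product using (_×_; _,_; proj₁; proj₂)
open import Data.Sum using (inj₁; inj₂)
open import Level using (Level)
open import Function using (_∘_; flip)
open import Function.Bundles using (_⇔_; mk⇔; Equivalence)
open import Relation.Nullary using (Dec; yes; no; does; contradiction)
open import Relation.Nullary.Decidable using (_×-dec_; _→-dec_; decidable-stable)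
open import Relation.Unary using (Pred; Decidable; _⊆_)
open import Relation.Binary.PropositionalEquality
open import Algebra.Properties.CommutativeSemigroup +-commutativeSemigroup
  using () renaming (interchange to +-interchange)
import Algebra.Properties.Semiring.Sum +-*-semiring as FinSum
open FinSum using (sum-syntax; sum-cong-≗; ∑-comm; ∑-permute; *-distribˡ-sum; *-distribʳ-sum)

private
  variable
    a b p q : Level
    A : Set a
    B : Set b
    P : Set p
    Q : Set q

𝟙 : Dec P → ℕ
𝟙 P? = if does P? then 1 else 0

𝟙-mono : (P → Q) → (P? : Dec P) (Q? : Dec Q) → 𝟙 P? ≤ 𝟙 Q?
𝟙-mono P→Q (no _)  _       = z≤n
𝟙-mono P→Q (yes _) (yes _) = ≤-refl
𝟙-mono P→Q (yes p) (no ¬q) = contradiction (P→Q p) ¬q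

𝟙-cong : P ⇔ Q → (P? : Dec P) (Q? : Dec Q) → 𝟙 P? ≡ 𝟙 Q?
𝟙-cong P⇔Q P? Q? = ≤-antisym (𝟙-mono to P? Q?) (𝟙-mono from Q? P?)
  where open Equivalence P⇔Q

𝟙-≡⇒→ : (P? : Dec P) (Q? : Dec Q) → 𝟙 P? ≡ 𝟙 Q? → P → Q
𝟙-≡⇒→ _       (yes q) _  _ = q
𝟙-≡⇒→ (yes _) (no _)  () _
𝟙-≡⇒→ (no ¬p) (no _)  _  p = contradiction p ¬p

𝟙-× : (P? : Dec P) (Q? : Dec Q) → 𝟙 (P? ×-dec Q?) ≡ 𝟙 P? * 𝟙 Q?
𝟙-× (yes _) (yes _) = refl
𝟙-× (yes _) (no _)  = refl
𝟙-× (no _)  _       = refl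

𝟙-≤-⊓ : ∀ k m n → 𝟙 (k ≤? m) * 𝟙 (k ≤? n) ≡ 𝟙 (k ≤? m ⊓ n)
𝟙-≤-⊓ k m n = trans (sym (𝟙-× (k ≤? m) (k ≤? n)))
  (𝟙-cong (mk⇔ (λ (k≤m , k≤n) → ⊓-glb k≤m k≤n)
               (λ k≤m⊓n → m≤n⊓o⇒m≤n m n k≤m⊓n , m≤n⊓o⇒m≤o m n k≤m⊓n))
          (k ≤? m ×-dec k ≤? n) (k ≤? m ⊓ n))

sum-map-zero : ∀ (xs : List A) → sum (map (λ _ → 0) xs) ≡ 0
sum-map-zero []       = refl
sum-map-zero (_ ∷ xs) = sum-map-zero xs

sum-map-+ : ∀ (f g : A → ℕ) xs →
  sum (map (λ x → f x + g x) xs) ≡ sum (map f xs) + sum (map g xs)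
sum-map-+ f g []       = refl
sum-map-+ f g (x ∷ xs) = begin
  (f x + g x) + sum (map (λ x → f x + g x) xs)     ≡⟨ cong (f x + g x +_) (sum-map-+ f g xs) ⟩
  (f x + g x) + (sum (map f xs) + sum (map g xs))  ≡⟨ +-interchange (f x) (g x) _ _ ⟩
  (f x + sum (map f xs)) + (g x + sum (map g xs))  ∎
  where open ≡-Reasoning

sum-map-*ˡ : ∀ c (f : A → ℕ) xs → c * sum (map f xs) ≡ sum (map (λ x → c * f x) xs)
sum-map-*ˡ c f []       = *-zeroʳ c
sum-map-*ˡ c f (x ∷ xs) = trans (*-distribˡ-+ c (f x) _) (cong (c * f x +_) (sum-map-*ˡ c f xs))

sum-map-*ʳ : ∀ c (f : A → ℕ) xs → sum (map f xs) * c ≡ sum (map (λ x → f x * c) xs)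
sum-map-*ʳ c f []       = refl
sum-map-*ʳ c f (x ∷ xs) = trans (*-distribʳ-+ c (f x) _) (cong (f x * c +_) (sum-map-*ʳ c f xs))

sum-map-square : ∀ (f : A → ℕ) xs →
  sum (map f xs) * sum (map f xs) ≡ sum (map (λ x → sum (map (λ y → f x * f y) xs)) xs)
sum-map-square f xs = trans (sum-map-*ʳ _ f xs) (cong sum (map-cong (λ x → sum-map-*ˡ (f x) f xs) xs))

sum-map-comm : ∀ (f : A → B → ℕ) xs ys →
  sum (map (λ x → sum (map (f x) ys)) xs) ≡ sum (map (λ y → sum (map (λ x → f x y) xs)) ys)
sum-map-comm f []       ys = sym (sum-map-zero ys)
sum-map-comm f (x ∷ xs) ys = trans (cong (sum (map (f x) ys) +_) (sum-map-comm f xs ys))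
                                   (sym (sum-map-+ (f x) _ ys))

length-filter≡sum-𝟙 : ∀ {P : Pred A p} (P? : Decidable P) xs →
  length (filter P? xs) ≡ sum (map (𝟙 ∘ P?) xs)
length-filter≡sum-𝟙 P? []       = refl
length-filter≡sum-𝟙 P? (x ∷ xs) with does (P? x)
... | true  = cong suc (length-filter≡sum-𝟙 P? xs)
... | false = length-filter≡sum-𝟙 P? xs

sum-map-tabulate : ∀ {n} (h : A → ℕ) (g : Fin n → A) →
  sum (map h (tabulate g)) ≡ ∑[ i < n ] h (g i)
sum-map-tabulate {n = zero}  h g = refl
sum-map-tabulate {n = suc n} h g = cong (h (g zero) +_) (sum-map-tabulate h (g ∘ suc))

∑-square : ∀ {n} (f : Fin n → ℕ) →
  (∑[ i < n ] f i) * (∑[ i < n ] f i) ≡ ∑[ i < n ] ∑[ j < n ] (f i * f j)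
∑-square f = trans (*-distribʳ-sum _ f) (sum-cong-≗ (λ i → *-distribˡ-sum (f i) f))

∑-mono-≤ : ∀ {n} {f g : Fin n → ℕ} → (∀ i → f i ≤ g i) → ∑[ i < n ] f i ≤ ∑[ i < n ] g i
∑-mono-≤ {zero}  f≤g = z≤n
∑-mono-≤ {suc n} f≤g = +-mono-≤ (f≤g zero) (∑-mono-≤ (f≤g ∘ suc))

k+l≡m+n⇒k≡m×l≡n : ∀ {k l m n} → k ≤ m → l ≤ n → k + l ≡ m + n → k ≡ m × l ≡ n
k+l≡m+n⇒k≡m×l≡n {k} {l} {m} {n} k≤m l≤n k+l≡m+n =
  k≡m , +-cancelˡ-≡ m l n (trans (cong (_+ l) (sym k≡m)) k+l≡m+n)
  where
  k≡m : k ≡ m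
  k≡m = ≤-antisym k≤m (+-cancelʳ-≤ n m k (≤-trans (≤-reflexive (sym k+l≡m+n)) (+-monoʳ-≤ k l≤n)))

∑-≡⇒≗ : ∀ {n} {f g : Fin n → ℕ} → (∀ i → f i ≤ g i) →
  ∑[ i < n ] f i ≡ ∑[ i < n ] g i → ∀ i → f i ≡ g i
∑-≡⇒≗ {suc n} f≤g ∑f≡∑g =
  let f₀≡g₀ , ∑f₊≡∑g₊ = k+l≡m+n⇒k≡m×l≡n (f≤g zero) (∑-mono-≤ (f≤g ∘ suc)) ∑f≡∑g
  in λ { zero → f₀≡g₀ ; (suc i) → ∑-≡⇒≗ (f≤g ∘ suc) ∑f₊≡∑g₊ i }

count : ∀ {n} {P : Pred (Fin n) p} → Decidable P → ℕ
count {n = n} P? = length (filter P? (allFin n))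

count≡∑𝟙 : ∀ {n} {P : Pred (Fin n) p} (P? : Decidable P) → count P? ≡ ∑[ i < n ] 𝟙 (P? i)
count≡∑𝟙 {n = n} P? =
  trans (length-filter≡sum-𝟙 P? (allFin n)) (sum-map-tabulate (𝟙 ∘ P?) (λ i → i))

module _ {n} {P : Pred (Fin n) p} {Q : Pred (Fin n) q}
         (P? : Decidable P) (Q? : Decidable Q) where

  count-mono : P ⊆ Q → count P? ≤ count Q?
  count-mono P⊆Q = subst₂ _≤_ (sym (count≡∑𝟙 P?)) (sym (count≡∑𝟙 Q?))
    (∑-mono-≤ (λ i → 𝟙-mono P⊆Q (P? i) (Q? i)))

  count≤⇒⊇ : P ⊆ Q → count Q? ≤ count P? → Q ⊆ P
  count≤⇒⊇ P⊆Q #Q≤#P {i} =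
    𝟙-≡⇒→ (Q? i) (P? i) (sym (∑-≡⇒≗ (λ i → 𝟙-mono P⊆Q (P? i) (Q? i)) ∑P≡∑Q i))
    where
    ∑P≡∑Q : ∑[ i < n ] 𝟙 (P? i) ≡ ∑[ i < n ] 𝟙 (Q? i)
    ∑P≡∑Q = subst₂ _≡_ (count≡∑𝟙 P?) (count≡∑𝟙 Q?) (≤-antisym (count-mono P⊆Q) #Q≤#P)

  count-reindex : (π : Permutation′ n) → (∀ i → P i ⇔ Q (π ⟨$⟩ʳ i)) → count P? ≡ count Q?
  count-reindex π P⇔Q∘π = begin
    count P?                      ≡⟨ count≡∑𝟙 P? ⟩
    ∑[ i < n ] 𝟙 (P? i)           ≡⟨ sum-cong-≗ (λ i → 𝟙-cong (P⇔Q∘π i) (P? i) (Q? (π ⟨$⟩ʳ i))) ⟩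
    ∑[ i < n ] 𝟙 (Q? (π ⟨$⟩ʳ i))  ≡⟨ ∑-permute (𝟙 ∘ Q?) π ⟨
    ∑[ i < n ] 𝟙 (Q? i)           ≡⟨ count≡∑𝟙 Q? ⟨
    count Q?                      ∎
    where open ≡-Reasoning

-- 0/1 matrices, given by a decidable relation between row and column indices

module _ {m n} {R : Fin m → Fin n → Set} (R? : ∀ a v → Dec (R a v)) where

  columnCount : Fin n → ℕ
  columnCount v = count (λ a → R? a v)

  columnOverlap : Fin n → Fin n → ℕ
  columnOverlap v w = count (λ a → R? a v ×-dec R? a w)

  NestedColumns : Set
  NestedColumns = ∀ v w → columnCount v ≤ columnCount w → ∀ a → R a v → R a w

  ∑rowCount²≡∑columnOverlap :
    ∑[ a < m ] (count (R? a) * count (R? a)) ≡ ∑[ v < n ] ∑[ w < n ] columnOverlap v w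
  ∑rowCount²≡∑columnOverlap = begin
    ∑[ a < m ] (count (R? a) * count (R? a))
      ≡⟨ sum-cong-≗ (λ a → trans (cong (λ c → c * c) (count≡∑𝟙 (R? a))) (∑-square (𝟙 ∘ R? a))) ⟩
    ∑[ a < m ] ∑[ v < n ] ∑[ w < n ] (𝟙 (R? a v) * 𝟙 (R? a w))
      ≡⟨ ∑-comm (λ a v → ∑[ w < n ] (𝟙 (R? a v) * 𝟙 (R? a w))) ⟩
    ∑[ v < n ] ∑[ a < m ] ∑[ w < n ] (𝟙 (R? a v) * 𝟙 (R? a w))
      ≡⟨ sum-cong-≗ (λ v → ∑-comm (λ a w → 𝟙 (R? a v) * 𝟙 (R? a w))) ⟩
    ∑[ v < n ] ∑[ w < n ] ∑[ a < m ] (𝟙 (R? a v) * 𝟙 (R? a w))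
      ≡⟨ sum-cong-≗ (λ v → sum-cong-≗ (λ w → sum-cong-≗ (λ a → 𝟙-× (R? a v) (R? a w)))) ⟨
    ∑[ v < n ] ∑[ w < n ] ∑[ a < m ] 𝟙 (R? a v ×-dec R? a w)
      ≡⟨ sum-cong-≗ (λ v → sum-cong-≗ (λ w → count≡∑𝟙 (λ a → R? a v ×-dec R? a w))) ⟨
    ∑[ v < n ] ∑[ w < n ] columnOverlap v w
      ∎
    where open ≡-Reasoning

  ∑rowCount²≡∑min⇒nestedColumns :
    ∑[ a < m ] (count (R? a) * count (R? a)) ≡ ∑[ v < n ] ∑[ w < n ] (columnCount v ⊓ columnCount w) →
    NestedColumns
  ∑rowCount²≡∑min⇒nestedColumns ∑²≡∑min v w #v≤#w a Rav =
    proj₂ (count≤⇒⊇ (λ a → R? a v ×-dec R? a w) (λ a → R? a v) proj₁ #v≤overlap Rav)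
    where
    overlap≤min : ∀ v w → columnOverlap v w ≤ columnCount v ⊓ columnCount w
    overlap≤min v w = ⊓-glb (count-mono _ (λ a → R? a v) proj₁) (count-mono _ (λ a → R? a w) proj₂)

    overlap≡min : ∀ v w → columnOverlap v w ≡ columnCount v ⊓ columnCount w
    overlap≡min v = ∑-≡⇒≗ (overlap≤min v)
      (∑-≡⇒≗ (λ v → ∑-mono-≤ (overlap≤min v)) (trans (sym ∑rowCount²≡∑columnOverlap) ∑²≡∑min) v)

    #v≤overlap : columnCount v ≤ columnOverlap v w
    #v≤overlap = ≤-reflexive (sym (trans (overlap≡min v w) (m≤n⇒m⊓n≡m #v≤#w)))

-- Either row j ⊆ row i, and then equal sizes force equality; or some column w separates them,
-- and comparing the sizes of columns a and w yields (j , a) ∈ R or a contradiction.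
nestedColumns⇒nestedRows : ∀ {m n} {R : Fin m → Fin n → Set} (R? : ∀ a v → Dec (R a v)) →
  NestedColumns R? → NestedColumns (flip R?)
nestedColumns⇒nestedRows {R = R} R? nested i j #i≤#j a Ria
  with all? (λ w → R? j w →-dec R? i w)
... | yes j⊆i = count≤⇒⊇ (R? j) (R? i) (j⊆i _) #i≤#j Ria
... | no j⊈i with ¬∀⟶∃¬ _ _ (λ w → R? j w →-dec R? i w) j⊈i
...   | w , ¬[Rjw→Riw] with ≤-total (columnCount R? a) (columnCount R? w)
...     | inj₁ #a≤#w = contradiction (λ _ → nested a w #a≤#w i Ria) ¬[Rjw→Riw]
...     | inj₂ #w≤#a = nested w a #w≤#a j Rjw
  where
  Rjw : R j w
  Rjw = decidable-stable (R? j w) (λ ¬Rjw → ¬[Rjw→Riw] (λ Rjw → contradiction Rjw ¬Rjw))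

-- Partitions

insertDesc-↭ : ∀ x ys → insertDesc x ys ↭ x ∷ ys
insertDesc-↭ x []       = ↭-refl
insertDesc-↭ x (y ∷ ys) with y ≤? x
... | yes _ = ↭-refl
... | no  _ = ↭-trans (↭-prep y (insertDesc-↭ x ys)) (↭-swap y x ↭-refl)

sortDesc-↭ : ∀ xs → sortDesc xs ↭ xs
sortDesc-↭ []       = ↭-refl
sortDesc-↭ (x ∷ xs) = ↭-trans (insertDesc-↭ x (sortDesc xs)) (↭-prep x (sortDesc-↭ xs))

sum-map-filter-positive : ∀ (h : ℕ → ℕ) → h 0 ≡ 0 → ∀ xs →
  sum (map h (filter (λ k → 1 ≤? k) xs)) ≡ sum (map h xs)
sum-map-filter-positive h h0≡0 []           = refl
sum-map-filter-positive h h0≡0 (zero  ∷ xs) =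
  trans (sum-map-filter-positive h h0≡0 xs) (cong (_+ sum (map h xs)) (sym h0≡0))
sum-map-filter-positive h h0≡0 (suc x ∷ xs) = cong (h (suc x) +_) (sum-map-filter-positive h h0≡0 xs)

sum-map-partitionOf : ∀ (h : ℕ → ℕ) → h 0 ≡ 0 → ∀ xs →
  sum (map h (partitionOf xs)) ≡ sum (map h xs)
sum-map-partitionOf h h0≡0 xs =
  trans (sum-map-filter-positive h h0≡0 (sortDesc xs)) (sum-↭ (map⁺ h (sortDesc-↭ xs)))

squareSum : List ℕ → ℕ
squareSum xs = sum (map (λ x → x * x) xs)

minSum : List ℕ → ℕ
minSum xs = sum (map (λ x → sum (map (x ⊓_) xs)) xs)

minSum-partitionOf : ∀ xs → minSum (partitionOf xs) ≡ minSum xs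
minSum-partitionOf xs = trans
  (cong sum (map-cong (λ x → sum-map-partitionOf (x ⊓_) (⊓-zeroʳ x) xs) (partitionOf xs)))
  (sum-map-partitionOf (λ x → sum (map (x ⊓_) xs)) (sum-map-zero xs) xs)

sum-map-upTo-suc : ∀ (h : ℕ → ℕ) M →
  sum (map h (upTo (suc M))) ≡ h 0 + sum (map (h ∘ suc) (upTo M))
sum-map-upTo-suc h M = cong (λ ks → h 0 + sum ks)
  (trans (map-applyUpTo suc h M) (sym (map-applyUpTo (λ k → k) (h ∘ suc) M)))

-- 𝟙 is defined through `does`, so 𝟙 (suc (suc k) ≤? suc t) and 𝟙 (suc k ≤? t) are
-- definitionally equal and the successor cases need no rewriting of the summand.
sum-map-upTo-𝟙< : ∀ M t → sum (map (λ k → 𝟙 (suc k ≤? t)) (upTo M)) ≡ t ⊓ M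
sum-map-upTo-𝟙< zero    t       = sym (⊓-zeroʳ t)
sum-map-upTo-𝟙< (suc M) zero    =
  trans (sum-map-upTo-suc (λ k → 𝟙 (suc k ≤? 0)) M) (sum-map-upTo-𝟙< M zero)
sum-map-upTo-𝟙< (suc M) (suc t) =
  trans (sum-map-upTo-suc (λ k → 𝟙 (suc k ≤? suc t)) M) (cong suc (sum-map-upTo-𝟙< M t))

All-≤-foldr-⊔ : ∀ xs → All (_≤ foldr _⊔_ 0 xs) xs
All-≤-foldr-⊔ []       = []
All-≤-foldr-⊔ (x ∷ xs) = m≤m⊔n x _ ∷ All.map (λ y≤⊔ → ≤-trans y≤⊔ (m≤n⊔m x _)) (All-≤-foldr-⊔ xs)

squareSum-conjugate : ∀ μ → squareSum (conjugate μ) ≡ minSum μ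
squareSum-conjugate μ = begin
  squareSum (conjugate μ)
    ≡⟨ cong sum (map-∘ (upTo M)) ⟨
  sum (map (λ k → #> k * #> k) (upTo M))
    ≡⟨ cong sum (map-cong #>² (upTo M)) ⟩
  sum (map (λ k → sum (map (λ x → sum (map (λ y → 𝟙 (suc k ≤? x ⊓ y)) μ)) μ)) (upTo M))
    ≡⟨ sum-map-comm (λ k x → sum (map (λ y → 𝟙 (suc k ≤? x ⊓ y)) μ)) (upTo M) μ ⟩
  sum (map (λ x → sum (map (λ k → sum (map (λ y → 𝟙 (suc k ≤? x ⊓ y)) μ)) (upTo M))) μ)
    ≡⟨ cong sum (map-cong (λ x → sum-map-comm (λ k y → 𝟙 (suc k ≤? x ⊓ y)) (upTo M) μ) μ) ⟩
  sum (map (λ x → sum (map (λ y → sum (map (λ k → 𝟙 (suc k ≤? x ⊓ y)) (upTo M))) μ)) μ)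
    ≡⟨ cong sum (map-cong-local (All.map ∑∑<x⊓y≡∑x⊓y (All-≤-foldr-⊔ μ))) ⟩
  minSum μ
    ∎
  where
  open ≡-Reasoning
  M : ℕ
  M = foldr _⊔_ 0 μ
  #> : ℕ → ℕ
  #> k = length (filter (λ m → suc k ≤? m) μ)
  #>² : ∀ k → #> k * #> k ≡ sum (map (λ x → sum (map (λ y → 𝟙 (suc k ≤? x ⊓ y)) μ)) μ)
  #>² k = begin
    #> k * #> k
      ≡⟨ cong (λ c → c * c) (length-filter≡sum-𝟙 (λ m → suc k ≤? m) μ) ⟩
    sum (map (λ m → 𝟙 (suc k ≤? m)) μ) * sum (map (λ m → 𝟙 (suc k ≤? m)) μ)
      ≡⟨ sum-map-square (λ m → 𝟙 (suc k ≤? m)) μ ⟩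
    sum (map (λ x → sum (map (λ y → 𝟙 (suc k ≤? x) * 𝟙 (suc k ≤? y)) μ)) μ)
      ≡⟨ cong sum (map-cong (λ x → cong sum (map-cong (𝟙-≤-⊓ (suc k) x) μ)) μ) ⟩
    sum (map (λ x → sum (map (λ y → 𝟙 (suc k ≤? x ⊓ y)) μ)) μ)
      ∎
  ∑∑<x⊓y≡∑x⊓y : ∀ {x} → x ≤ M →
    sum (map (λ y → sum (map (λ k → 𝟙 (suc k ≤? x ⊓ y)) (upTo M))) μ) ≡ sum (map (x ⊓_) μ)
  ∑∑<x⊓y≡∑x⊓y {x} x≤M = cong sum (map-cong (λ y →
    trans (sum-map-upTo-𝟙< M (x ⊓ y)) (m≤n⇒m⊓n≡m (≤-trans (m⊓n≤m x y) x≤M))) μ)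

squareSum≡minSum : ∀ xs ys → partitionOf xs ≡ conjugate (partitionOf ys) → squareSum xs ≡ minSum ys
squareSum≡minSum xs ys xs′≡ys′ = begin
  squareSum xs                          ≡⟨ sum-map-partitionOf (λ x → x * x) refl xs ⟨
  squareSum (partitionOf xs)            ≡⟨ cong squareSum xs′≡ys′ ⟩
  squareSum (conjugate (partitionOf ys)) ≡⟨ squareSum-conjugate (partitionOf ys) ⟩
  minSum (partitionOf ys)               ≡⟨ minSum-partitionOf ys ⟩
  minSum ys                             ∎
  where open ≡-Reasoning

squareSum-map-allFin : ∀ {n} (f : Fin n → ℕ) → squareSum (map f (allFin n)) ≡ ∑[ i < n ] (f i * f i)
squareSum-map-allFin {n} f =
  trans (cong sum (sym (map-∘ (allFin n)))) (sum-map-tabulate (λ i → f i * f i) (λ i → i))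

minSum-map-allFin : ∀ {n} (f : Fin n → ℕ) →
  minSum (map f (allFin n)) ≡ ∑[ i < n ] ∑[ j < n ] (f i ⊓ f j)
minSum-map-allFin {n} f = begin
  minSum (map f (allFin n))
    ≡⟨ cong sum (map-∘ (allFin n)) ⟨
  sum (map (λ i → sum (map (f i ⊓_) (map f (allFin n)))) (allFin n))
    ≡⟨ sum-map-tabulate (λ i → sum (map (f i ⊓_) (map f (allFin n)))) (λ i → i) ⟩
  ∑[ i < n ] sum (map (f i ⊓_) (map f (allFin n)))
    ≡⟨ sum-cong-≗ (λ i → trans (cong sum (sym (map-∘ (allFin n))))
                                (sum-map-tabulate (λ j → f i ⊓ f j) (λ j → j))) ⟩
  ∑[ i < n ] ∑[ j < n ] (f i ⊓ f j)
    ∎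
  where open ≡-Reasoning

-- Inversions of σ

module _ {n} (σ : Permutation′ n) where

  Inv-⟨$⟩ʳ : ∀ i j → (j < i × σ ⟨$⟩ʳ i < σ ⟨$⟩ʳ j) ⇔ Inv σ (σ ⟨$⟩ʳ i) (σ ⟨$⟩ʳ j)
  Inv-⟨$⟩ʳ i j = mk⇔ (λ (j<i , σi<σj) → σi<σj , subst₂ _<_ (sym σ⁻¹σ) (sym σ⁻¹σ) j<i)
                     (λ (σi<σj , j<i) → subst₂ _<_ σ⁻¹σ σ⁻¹σ j<i , σi<σj)
    where
    σ⁻¹σ : ∀ {k} → σ ⟨$⟩ˡ (σ ⟨$⟩ʳ k) ≡ k
    σ⁻¹σ = inverseˡ σ

  gStat≡cStat : ∀ i → gStat σ i ≡ cStat σ (σ ⟨$⟩ʳ i)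
  gStat≡cStat i = count-reindex _ (Inv? σ (σ ⟨$⟩ʳ i)) σ (Inv-⟨$⟩ʳ i)

  dStat≡lStat : ∀ i → dStat σ i ≡ lStat σ (σ ⟨$⟩ʳ i)
  dStat≡lStat i = count-reindex _ (λ a → Inv? σ a (σ ⟨$⟩ʳ i)) σ (λ j → Inv-⟨$⟩ʳ j i)

  vexillary⇒∑c²≡∑l⊓l : Vexillary σ →
    ∑[ a < n ] (cStat σ a * cStat σ a) ≡ ∑[ v < n ] ∑[ w < n ] (lStat σ v ⊓ lStat σ w)
  vexillary⇒∑c²≡∑l⊓l vexillary = begin
    ∑[ a < n ] (cStat σ a * cStat σ a)
      ≡⟨ ∑-permute (λ a → cStat σ a * cStat σ a) σ ⟩
    ∑[ i < n ] (cStat σ (σ ⟨$⟩ʳ i) * cStat σ (σ ⟨$⟩ʳ i))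
      ≡⟨ sum-cong-≗ (λ i → cong₂ _*_ (gStat≡cStat i) (gStat≡cStat i)) ⟨
    ∑[ i < n ] (gStat σ i * gStat σ i)
      ≡⟨ squareSum-map-allFin (gStat σ) ⟨
    squareSum (map (gStat σ) (allFin n))
      ≡⟨ squareSum≡minSum (map (gStat σ) (allFin n)) (map (dStat σ) (allFin n)) vexillary ⟩
    minSum (map (dStat σ) (allFin n))
      ≡⟨ minSum-map-allFin (dStat σ) ⟩
    ∑[ i < n ] ∑[ j < n ] (dStat σ i ⊓ dStat σ j)
      ≡⟨ sum-cong-≗ (λ i → sum-cong-≗ (λ j → cong₂ _⊓_ (dStat≡lStat i) (dStat≡lStat j))) ⟩
    ∑[ i < n ] ∑[ j < n ] (lStat σ (σ ⟨$⟩ʳ i) ⊓ lStat σ (σ ⟨$⟩ʳ j))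
      ≡⟨ sum-cong-≗ (λ i → ∑-permute (λ w → lStat σ (σ ⟨$⟩ʳ i) ⊓ lStat σ w) σ) ⟨
    ∑[ i < n ] ∑[ w < n ] (lStat σ (σ ⟨$⟩ʳ i) ⊓ lStat σ w)
      ≡⟨ ∑-permute (λ v → ∑[ w < n ] (lStat σ v ⊓ lStat σ w)) σ ⟨
    ∑[ v < n ] ∑[ w < n ] (lStat σ v ⊓ lStat σ w)
      ∎
    where open ≡-Reasoning

mainTheorem13 : (n : ℕ) (σ : Permutation′ n) → Vexillary σ → (i j : Fin n) →
    ((lStat σ i ≤ lStat σ j → (a : Fin n) → Inv σ a i → Inv σ a j)
    × (cStat σ i ≤ cStat σ j → (a : Fin n) → Inv σ i a → Inv σ j a))
mainTheorem13 n σ vexillary i j = nestedLeft i j , nestedColumns⇒nestedRows (Inv? σ) nestedLeft i j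
  where
  nestedLeft : NestedColumns (Inv? σ)
  nestedLeft = ∑rowCount²≡∑min⇒nestedColumns (Inv? σ) (vexillary⇒∑c²≡∑l⊓l σ vexillary)
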